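{- Let $\mathcal C\subseteq 2^{[n]}$ be a neural code and let $T$ be a (possibly empty) trunk in $\mathcal C$. Then $\{\varnothing\}\cup T\le\mathcal C$, i.e. there is a surjective morphism of neural codes $\mathcal C\to\{\varnothing\}\cup T$.
   Context: A neural code is a set $\mathcal C\subseteq 2^{[n]}$ (where $[n]=\{1,\dots,n\}$) that contains the empty codeword $\varnothing$; its elements are codewords. For $\sigma\subseteq[n]$, the trunk of $\sigma$ is $\mathrm{Tk}_{\mathcal C}(\sigma)=\{\tau\in\mathcal C:\sigma\subseteq\tau\}$; a trunk in $\mathcal C$ is any set of this form. A trunk is proper if it is nonempty and not equal to $\mathrm{Tk}_{\mathcal C}(\varnothing)=\mathcal C$. A morphism $f:\mathcal C\to\mathcal D$ of neural codes is a function such that for every proper trunk $T'$ in $\mathcal D$, the preimage $f^{ -1}(T')$ is a proper trunk in $\mathcal C$. We write $\mathcal D\le\mathcal C$ if there is a surjective morphism $\mathcal C\to\mathcal D$. -}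

module Defs where

open import Data.Nat using (ℕ; zero; suc)
open import Data.Vec using ([]; _∷_)
open import Data.Bool.Properties using (T-∨)
open import Data.Sum using (inj₁)
import Function.Bundles
open import Data.Bool using (Bool; true; false; T; _∧_; _∨_)
import Data.Bool as B
open import Data.Fin.Subset using (Subset; ⊥; _⊆_)
open import Data.Fin.Subset.Properties using (_⊆?_)
open import Data.Product using (Σ; ∃; _×_; _,_; proj₁)
open import Relation.Nullary using (¬_; Dec; does)
open import Relation.Binary.PropositionalEquality using (_≡_; refl)
open import Function.Bundles using (_⇔_)

record Code (n : ℕ) : Set where
  field
    mem   : Subset n → Bool
    has∅  : T (mem ⊥)
open Code public

Word : {n : ℕ} → Code n → Set
Word {n} C = Σ (Subset n) (λ c → T (mem C c))

word : {n : ℕ} (C : Code n) → Word C → Subset n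
word C = proj₁

IsTrunkOf : {n : ℕ} (C : Code n) (σ : Subset n) (S : Word C → Set) → Set
IsTrunkOf C σ S = ∀ c → S c ⇔ (σ ⊆ word C c)

IsProperTrunk : {n : ℕ} (C : Code n) (S : Word C → Set) → Set
IsProperTrunk {n} C S =
  (Σ (Subset n) λ σ → IsTrunkOf C σ S) × (∃ λ c → S c) × ¬ (∀ c → S c)

Tk : {m : ℕ} (D : Code m) (σ : Subset m) → Word D → Set
Tk D σ d = σ ⊆ word D d

IsMorphism : {n m : ℕ} (C : Code n) (D : Code m) → (Word C → Word D) → Set
IsMorphism {n} {m} C D f =
  (σ' : Subset m) → IsProperTrunk D (Tk D σ') →
    IsProperTrunk C (λ c → Tk D σ' (f c))

Surjective : {n m : ℕ} (C : Code n) (D : Code m) → (Word C → Word D) → Set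
Surjective C D f = ∀ d → ∃ λ c → word D (f c) ≡ word D d

_≤ᶜ_ : {n m : ℕ} → Code m → Code n → Set
_≤ᶜ_ {n} {m} D C =
  Σ (Word C → Word D) λ f → IsMorphism C D f × Surjective C D f

isEmpty : {n : ℕ} → Subset n → Bool
isEmpty []           = true
isEmpty (true  ∷ x)  = false
isEmpty (false ∷ x)  = isEmpty x

isEmpty-⊥ : (n : ℕ) → T (isEmpty (⊥ {n}))
isEmpty-⊥ zero    = _
isEmpty-⊥ (suc n) = isEmpty-⊥ n

∅∪Tk : {n : ℕ} → Code n → Subset n → Code n
∅∪Tk {n} C σ = record
  { mem  = λ x → isEmpty x ∨ (mem C x ∧ does (σ ⊆? x))
  ; has∅ = T-∨ .Function.Bundles.Equivalence.from (inj₁ (isEmpty-⊥ n)) }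

{-# OPTIONS --safe #-}
-- The map sending a codeword c to itself when σ ⊆ c and to ∅ otherwise is onto {∅} ∪ Tk_C(σ).
-- Since every code contains ∅, a trunk Tk(σ') is proper exactly when it is nonempty and σ' ≠ ∅,
-- and for σ' ≠ ∅ the preimage of Tk(σ') under this map is Tk_C(σ ∪ σ').
module Submission where

open import Defs
open import Data.Nat using (ℕ)
open import Data.Fin.Subset using (Subset; ⊥; _⊆_; _∪_)
open import Data.Fin.Subset.Properties using (_⊆?_; ⊥⊆; ⊆-reflexive; ⊆-trans; p⊆p∪q; q⊆p∪q; x∈p∪q⁻)
open import Data.Bool using (false; T)
open import Data.Bool.Properties using (T-∨; T-∧)
open import Data.Vec using ([]; _∷_)
open import Data.Sum using (_⊎_; inj₁; inj₂)
open import Data.Empty using (⊥-elim)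
open import Data.Product using (∃; _×_; _,_; proj₁; proj₂)
open import Relation.Nullary using (¬_; Dec; yes; no)
open import Relation.Binary.PropositionalEquality using (_≡_; refl; sym; trans; cong)
open import Function.Bundles using (_⇔_; mk⇔; Equivalence)

private
  variable
    n : ℕ

isEmpty⇒≡⊥ : (x : Subset n) → T (isEmpty x) → x ≡ ⊥
isEmpty⇒≡⊥ []          _ = refl
isEmpty⇒≡⊥ (false ∷ x) p = cong (false ∷_) (isEmpty⇒≡⊥ x p)

∪-lub : {p q r : Subset n} → p ⊆ r → q ⊆ r → p ∪ q ⊆ r
∪-lub {p = p} {q} p⊆r q⊆r x∈p∪q with x∈p∪q⁻ p q x∈p∪q
... | inj₁ x∈p = p⊆r x∈p
... | inj₂ x∈q = q⊆r x∈q

∅ : (C : Code n) → Word C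
∅ C = ⊥ , has∅ C

Tk-proper⇒⊈⊥ : (C : Code n) {τ : Subset n} → IsProperTrunk C (Tk C τ) → ¬ τ ⊆ ⊥
Tk-proper⇒⊈⊥ C (_ , _ , ¬all) τ⊆⊥ = ¬all (λ c → ⊆-trans τ⊆⊥ ⊥⊆)

trunk-proper : (C : Code n) {τ : Subset n} {S : Word C → Set} →
               IsTrunkOf C τ S → ∃ S → ¬ τ ⊆ ⊥ → IsProperTrunk C S
trunk-proper C {τ} {S} S≡Tkτ nonempty τ⊈⊥ = (τ , S≡Tkτ) , nonempty , ¬all
  where
  ¬all : ¬ (∀ c → S c)
  ¬all all = τ⊈⊥ (Equivalence.to (S≡Tkτ (∅ C)) (all (∅ C)))

module _ (C : Code n) (σ : Subset n) where

  ∅∪Tk-mem⁻ : (x : Subset n) → T (mem (∅∪Tk C σ) x) → x ≡ ⊥ ⊎ (T (mem C x) × σ ⊆ x)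
  ∅∪Tk-mem⁻ x x∈D with σ ⊆? x
  ... | yes σ⊆x with Equivalence.to T-∨ x∈D
  ...   | inj₁ x-empty = inj₁ (isEmpty⇒≡⊥ x x-empty)
  ...   | inj₂ x∈C∧⊤   = inj₂ (proj₁ (Equivalence.to T-∧ x∈C∧⊤) , σ⊆x)
  ∅∪Tk-mem⁻ x x∈D | no _ with Equivalence.to T-∨ x∈D
  ...   | inj₁ x-empty = inj₁ (isEmpty⇒≡⊥ x x-empty)
  ...   | inj₂ x∈C∧⊥   = ⊥-elim (proj₂ (Equivalence.to T-∧ x∈C∧⊥))

  ∅∪Tk-mem⁺ : {x : Subset n} → T (mem C x) → σ ⊆ x → T (mem (∅∪Tk C σ) x)
  ∅∪Tk-mem⁺ {x} x∈C σ⊆x with σ ⊆? x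
  ... | yes _   = Equivalence.from T-∨ (inj₂ (Equivalence.from T-∧ (x∈C , _)))
  ... | no σ⊈x = ⊥-elim (σ⊈x σ⊆x)

  collapse : Word C → Word (∅∪Tk C σ)
  collapse (x , x∈C) with σ ⊆? x
  ... | yes σ⊆x = x , ∅∪Tk-mem⁺ x∈C σ⊆x
  ... | no _    = ∅ (∅∪Tk C σ)

  collapse-⊆ : (c : Word C) → σ ⊆ proj₁ c → proj₁ (collapse c) ≡ proj₁ c
  collapse-⊆ (x , _) σ⊆x with σ ⊆? x
  ... | yes _   = refl
  ... | no σ⊈x = ⊥-elim (σ⊈x σ⊆x)

  collapse-⊈ : (c : Word C) → ¬ σ ⊆ proj₁ c → proj₁ (collapse c) ≡ ⊥
  collapse-⊈ (x , _) σ⊈x with σ ⊆? x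
  ... | yes σ⊆x = ⊥-elim (σ⊈x σ⊆x)
  ... | no _    = refl

  collapse-preimage : {σ' : Subset n} → ¬ σ' ⊆ ⊥ →
                      IsTrunkOf C (σ ∪ σ') (λ c → Tk (∅∪Tk C σ) σ' (collapse c))
  collapse-preimage {σ'} σ'⊈⊥ c = mk⇔ (to (σ ⊆? proj₁ c)) (from (σ ⊆? proj₁ c))
    where
    to : Dec (σ ⊆ proj₁ c) → σ' ⊆ proj₁ (collapse c) → σ ∪ σ' ⊆ proj₁ c
    to (yes σ⊆c) σ'⊆fc = ∪-lub σ⊆c (⊆-trans σ'⊆fc (⊆-reflexive (collapse-⊆ c σ⊆c)))
    to (no σ⊈c)  σ'⊆fc = ⊥-elim (σ'⊈⊥ (⊆-trans σ'⊆fc (⊆-reflexive (collapse-⊈ c σ⊈c))))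

    from : Dec (σ ⊆ proj₁ c) → σ ∪ σ' ⊆ proj₁ c → σ' ⊆ proj₁ (collapse c)
    from (yes σ⊆c) σ∪σ'⊆c = ⊆-trans (⊆-trans (q⊆p∪q σ σ') σ∪σ'⊆c) (⊆-reflexive (sym (collapse-⊆ c σ⊆c)))
    from (no σ⊈c)  σ∪σ'⊆c = ⊥-elim (σ⊈c (⊆-trans (p⊆p∪q σ') σ∪σ'⊆c))

  collapse-∅ : proj₁ (collapse (∅ C)) ≡ ⊥
  collapse-∅ with σ ⊆? ⊥
  ... | yes _ = refl
  ... | no _  = refl

  collapse-surjective : Surjective C (∅∪Tk C σ) collapse
  collapse-surjective (x , x∈D) with ∅∪Tk-mem⁻ x x∈D
  ... | inj₁ x≡⊥        = ∅ C , trans collapse-∅ (sym x≡⊥)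
  ... | inj₂ (x∈C , σ⊆x) = (x , x∈C) , collapse-⊆ (x , x∈C) σ⊆x

  collapse-morphism : IsMorphism C (∅∪Tk C σ) collapse
  collapse-morphism σ' Tkσ'-proper@(_ , ((d , d∈D) , σ'⊆d) , _) =
    trunk-proper C (collapse-preimage σ'⊈⊥) nonempty (λ σ∪σ'⊆⊥ → σ'⊈⊥ (⊆-trans (q⊆p∪q σ σ') σ∪σ'⊆⊥))
    where
    σ'⊈⊥ : ¬ σ' ⊆ ⊥
    σ'⊈⊥ = Tk-proper⇒⊈⊥ (∅∪Tk C σ) Tkσ'-proper

    nonempty : ∃ λ c → σ' ⊆ proj₁ (collapse c)
    nonempty with collapse-surjective (d , d∈D)
    ... | c , fc≡d = c , ⊆-trans σ'⊆d (⊆-reflexive (sym fc≡d))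

proposition12 : (n : ℕ) (C : Code n) (σ : Subset n) → ∅∪Tk C σ ≤ᶜ C
proposition12 n C σ = collapse C σ , collapse-morphism C σ , collapse-surjective C σ
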